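{- Let $m,m'\ge0$ and $n\ge0$. If $m$ is odd, then for every $m'\ge0$, \[ u_m(u_{m'}(n))=2u_{m'}(n)+1-c_m(n),\quad v_m(v_{m'}(n))=2v_{m'}(n)+c_m(n), \] \[ u_m(v_{m'}(n))=2v_{m'}(n)+1-c_m(n),\quad v_m(u_{m'}(n))=2u_{m'}(n)+c_m(n). \] If $m\ge2$ is even, then \[ u_m(u_{m'}(n))=2u_{m'}(n)+\gamma_{m,m'}(n),\quad v_m(v_{m'}(n))=2v_{m'}(n)+\gamma_{m,m'}(n), \] \[ u_m(v_{m'}(n))=2v_{m'}(n)+1-\gamma_{m,m'}(n),\quad v_m(u_{m'}(n))=2u_{m'}(n)+1-\gamma_{m,m'}(n). \]
   Context: For $n\ge0$ write $b_p(n)=\lfloor n/2^p\rfloor\bmod 2$; $\oplus$ is XOR and $\&$ is bitwise AND. For $m\ge0$ let $a_m(n)=\bigoplus_{p\ge0,\ p\,\&\,m=0} b_p(n)$. Let $v_m(n)$ (resp. $u_m(n)$), $n\ge0$, be the $n$-th (indexing from $0$) nonnegative integer, in increasing order, at which $a_m$ equals $0$ (resp. $1$). Define $\gamma_{m,m'}(n)=a_m(4n)\oplus a_{m'}(2n)$. Let $K(m)=\max(1,\lceil\log_2(m+1)\rceil)$. The correction set $C(m)\subseteq\mathbb N$ is defined recursively: $C(0)=\emptyset$; for odd $m\ge1$, with $K=K(m)$ and $r=m-2^{K-1}$, $C(m)$ is periodic with period $2^K$ and $C(m)\cap[0,2^K)=\{2^K-2\}\cup(C(r)\cap[0,2^{K-1}-2))$;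 for even $m\ge2$, $C(m)=C(m-1)$. Set $c_m(n)=\bigoplus_{p\in C(m)}b_p(n)$. -}

module Defs where

open import Data.Nat using (ℕ; zero; suc; _+_; _*_; _∸_; _^_; _<ᵇ_; _≡ᵇ_; _⊔_)
open import Data.Nat.DivMod using (_/_; _%_)
open import Data.Nat.Properties using (m^n≢0)
open import Data.Nat.Logarithm using (⌈log₂_⌉)
open import Data.Bool using (Bool; true; false; not; _∧_; _∨_; _xor_; if_then_else_)
open import Data.List using (List; foldr; map; upTo)
open import Data.Product using (_×_)
open import Relation.Binary.PropositionalEquality using (_≡_)

⟦_⟧ : Bool → ℕ
⟦ true ⟧ = 1
⟦ false ⟧ = 0

bit : ℕ → ℕ → Bool
bit p n = (_/_ n (2 ^ p) {{m^n≢0 2 p}}) % 2 ≡ᵇ 1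

⨁ : List Bool → Bool
⨁ = foldr _xor_ false

-- p & m = 0  (no common 1-bit; bits of p above position p are all 0)
andZero : ℕ → ℕ → Bool
andZero p m = foldr _∧_ true (map (λ i → not (bit i p ∧ bit i m)) (upTo (suc p)))

-- a_m(n) = XOR_{p ≥ 0, p & m = 0} b_p(n).  Only p ≤ n can contribute,
-- since b_p(n) = 0 whenever 2^p > n (in particular for p > n).
a : ℕ → ℕ → Bool
a m n = ⨁ (map (λ p → andZero p m ∧ bit p n) (upTo (suc n)))

K : ℕ → ℕ
K m = 1 ⊔ ⌈log₂ (suc m) ⌉

-- membership p ∈ C(m), via the recursive definition; the first argument is
-- fuel, and fuel m+1 always suffices since the recursion strictly decreases m.
inC-fuel : ℕ → ℕ → ℕ → Bool
inC-fuel zero    _       _ = false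
inC-fuel (suc f) zero    _ = false
inC-fuel (suc f) (suc k) p =
  if (suc k % 2 ≡ᵇ 1)
  then ((q ≡ᵇ (2 ^ Km ∸ 2)) ∨ ((q <ᵇ (2 ^ (Km ∸ 1) ∸ 2)) ∧ inC-fuel f (suc k ∸ 2 ^ (Km ∸ 1)) q))
  else inC-fuel f k p
  where
  Km : ℕ
  Km = K (suc k)
  q : ℕ
  q = _%_ p (2 ^ Km) {{m^n≢0 2 Km}}

inC : ℕ → ℕ → Bool
inC m p = inC-fuel (suc m) m p

c : ℕ → ℕ → Bool
c m n = ⨁ (map (λ p → inC m p ∧ bit p n) (upTo (suc n)))

γ : ℕ → ℕ → ℕ → Bool
γ m m' n = a m (4 * n) xor a m' (2 * n)

count : (ℕ → Bool) → ℕ → ℕ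
count f zero = 0
count f (suc x) = count f x + ⟦ f x ⟧

-- x is the n-th (from 0) natural number at which f is true
IsNth : (ℕ → Bool) → ℕ → ℕ → Set
IsNth f n x = (f x ≡ true) × (count f x ≡ n)

-- U m n x  means  u_m(n) = x ;  V m n x  means  v_m(n) = x
U : ℕ → ℕ → ℕ → Set
U m n x = IsNth (a m) n x

V : ℕ → ℕ → ℕ → Set
V m n x = IsNth (λ k → not (a m k)) n x

-- Flipping bit 0 of n flips a_m(n), since p = 0 always satisfies p & m = 0. So a_m alternates on
-- each pair {2k, 2k+1}, whence u_m(k) = 2k + 1 - a_m(2k) and v_m(k) = 2k + a_m(2k). Both u_{m'}(n)
-- and v_{m'}(n) have the form x = 2n + e, and the bits of 2x = 4n + 2e are e at position 1 and
-- those of n from position 2 on, so a_m(2x) = ([1 & m = 0] ∧ e) ⊕ a_m(4n). For even m this is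
-- e ⊕ a_m(4n), which gives the γ-formulas. For odd m the first term vanishes and a_m(4n) = c_m(n),
-- because C(m) = {q : (q + 2) & m = 0}; this is proved along the recursion defining C(m), writing
-- m = 2^(K-1) + r and reducing q + 2 modulo 2^K.

module Submission where

open import Data.Bool using (Bool; true; false; not; _∧_; _∨_; _xor_; if_then_else_)
open import Data.Bool.ListAction using (and)
open import Data.Bool.Properties
  using (not-involutive; not-injective; ¬-not; ∧-zeroʳ; ∧-identityʳ; xor-comm; not-distribˡ-xor; ⇔→≡)
open import Data.List using (applyUpTo)
open import Data.List.Properties using (map-upTo)
open import Data.Nat
open import Data.Nat.DivMod
open import Data.Nat.Divisibility using (_∣_; m∣m*n)
open import Data.Nat.Logarithm
  using (⌈log₂_⌉; ⌈log₂⌉-mono-≤; ⌈log₂2^n⌉≡n; ⌈log₂⌈n/2⌉⌉≡⌈log₂n⌉∸1)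
open import Data.Nat.Properties
open import Data.Nat.Tactic.RingSolver using (solve-∀)
open import Data.Product using (_×_; _,_; proj₁; proj₂; ∃-syntax)
open import Data.Sum using (inj₁; inj₂)
open import Function using (_∘_; _⇔_; mk⇔; Equivalence)
open import Relation.Binary.PropositionalEquality
open import Relation.Binary.Definitions using (tri<; tri≈; tri>)
open import Relation.Nullary using (¬_; yes; no)
open import Relation.Nullary.Decidable using (dec-true; dec-false)

open import Defs

halve : ∀ n → ∃[ k ] ∃[ b ] n ≡ 2 * k + ⟦ b ⟧
halve zero = 0 , false , refl
halve (suc n) with halve n
... | k , false , refl = k , true , sym (+-suc (2 * k) 0)
... | k , true  , refl = suc k , false , lemma k
  where
  lemma : ∀ k → suc (2 * k + 1) ≡ 2 * suc k + 0
  lemma = solve-∀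

[2k+b]/2≡k : ∀ k b → (2 * k + ⟦ b ⟧) / 2 ≡ k
[2k+b]/2≡k k b = begin
  (2 * k + ⟦ b ⟧) / 2    ≡⟨ +-distrib-/-∣ˡ ⟦ b ⟧ (m∣m*n k) ⟩
  2 * k / 2 + ⟦ b ⟧ / 2  ≡⟨ cong₂ _+_ (trans (/-congˡ (*-comm 2 k)) (m*n/n≡m k 2)) (⟦b⟧/2≡0 b) ⟩
  k + 0                  ≡⟨ +-identityʳ k ⟩
  k                      ∎
  where
  open ≡-Reasoning
  ⟦b⟧/2≡0 : ∀ b → ⟦ b ⟧ / 2 ≡ 0
  ⟦b⟧/2≡0 false = refl
  ⟦b⟧/2≡0 true  = refl

[2k+b]%2≡b : ∀ k b → (2 * k + ⟦ b ⟧) % 2 ≡ ⟦ b ⟧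
[2k+b]%2≡b k b = begin
  (2 * k + ⟦ b ⟧) % 2  ≡⟨ %-congˡ (trans (+-comm (2 * k) ⟦ b ⟧) (cong (⟦ b ⟧ +_) (*-comm 2 k))) ⟩
  (⟦ b ⟧ + k * 2) % 2  ≡⟨ [m+kn]%n≡m%n ⟦ b ⟧ k 2 ⟩
  ⟦ b ⟧ % 2            ≡⟨ ⟦b⟧%2≡⟦b⟧ b ⟩
  ⟦ b ⟧                ∎
  where
  open ≡-Reasoning
  ⟦b⟧%2≡⟦b⟧ : ∀ b → ⟦ b ⟧ % 2 ≡ ⟦ b ⟧
  ⟦b⟧%2≡⟦b⟧ false = refl
  ⟦b⟧%2≡⟦b⟧ true  = refl

bit-zero : ∀ n → bit 0 n ≡ (n % 2 ≡ᵇ 1)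
bit-zero n = cong (λ x → x % 2 ≡ᵇ 1) (n/1≡n n)

bit-suc : ∀ p n → bit (suc p) n ≡ bit p (n / 2)
bit-suc p n = cong (λ x → x % 2 ≡ᵇ 1)
  (sym (m/n/o≡m/[n*o] n 2 (2 ^ p) {{_}} {{m^n≢0 2 p}} {{m^n≢0 2 (suc p)}}))

bit-zero-[2k+b] : ∀ k b → bit 0 (2 * k + ⟦ b ⟧) ≡ b
bit-zero-[2k+b] k b =
  trans (bit-zero (2 * k + ⟦ b ⟧)) (trans (cong (_≡ᵇ 1) ([2k+b]%2≡b k b)) (⟦b⟧≡ᵇ1 b))
  where
  ⟦b⟧≡ᵇ1 : ∀ b → (⟦ b ⟧ ≡ᵇ 1) ≡ b
  ⟦b⟧≡ᵇ1 false = refl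
  ⟦b⟧≡ᵇ1 true  = refl

bit-suc-[2k+b] : ∀ p k b → bit (suc p) (2 * k + ⟦ b ⟧) ≡ bit p k
bit-suc-[2k+b] p k b = trans (bit-suc p (2 * k + ⟦ b ⟧)) (cong (bit p) ([2k+b]/2≡k k b))

bit-< : ∀ i x → x < 2 ^ i → bit i x ≡ false
bit-< zero    zero    _ = refl
bit-< zero    (suc x) (s≤s ())
bit-< (suc i) x       x<2^[1+i] = trans (bit-suc i x)
  (bit-< i (x / 2) (m<n*o⇒m/o<n (subst (x <_) (*-comm 2 (2 ^ i)) x<2^[1+i])))

n<2^n : ∀ n → n < 2 ^ n
n<2^n zero    = s≤s z≤n
n<2^n (suc n) = begin-strict
  suc n          ≤⟨ n<2^n n ⟩
  2 ^ n          <⟨ m<m+n (2 ^ n) (m^n>0 2 n) ⟩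
  2 ^ n + 2 ^ n  ≡⟨ cong (2 ^ n +_) (sym (+-identityʳ (2 ^ n))) ⟩
  2 ^ suc n      ∎
  where open ≤-Reasoning

bit-≤ : ∀ i x → x ≤ i → bit i x ≡ false
bit-≤ i x x≤i = bit-< i x (≤-<-trans x≤i (n<2^n i))

private
  2^[1+j]y+[2z+b] : ∀ j y z b → 2 ^ suc j * y + (2 * z + ⟦ b ⟧) ≡ 2 * (2 ^ j * y + z) + ⟦ b ⟧
  2^[1+j]y+[2z+b] j y z b = lemma (2 ^ j) y z ⟦ b ⟧
    where
    lemma : ∀ h y z b → 2 * h * y + (2 * z + b) ≡ 2 * (h * y + z) + b
    lemma = solve-∀

  2z+b<2^[1+j]⇒z<2^j : ∀ j z b → 2 * z + ⟦ b ⟧ < 2 ^ suc j → z < 2 ^ j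
  2z+b<2^[1+j]⇒z<2^j j z b lt = *-cancelˡ-< 2 z (2 ^ j) (≤-<-trans (m≤m+n (2 * z) ⟦ b ⟧) lt)

bit-low-[2^j*y+z] : ∀ j y z i → z < 2 ^ j → i < j → bit i (2 ^ j * y + z) ≡ bit i z
bit-low-[2^j*y+z] (suc j) y z zero z< _ with halve z
... | z′ , b , refl rewrite 2^[1+j]y+[2z+b] j y z′ b =
  trans (bit-zero-[2k+b] (2 ^ j * y + z′) b) (sym (bit-zero-[2k+b] z′ b))
bit-low-[2^j*y+z] (suc j) y z (suc i) z< (s≤s i<j) with halve z
... | z′ , b , refl rewrite 2^[1+j]y+[2z+b] j y z′ b = begin
  bit (suc i) (2 * (2 ^ j * y + z′) + ⟦ b ⟧)  ≡⟨ bit-suc-[2k+b] i (2 ^ j * y + z′) b ⟩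
  bit i (2 ^ j * y + z′)                      ≡⟨ bit-low-[2^j*y+z] j y z′ i z′<2^j i<j ⟩
  bit i z′                                    ≡⟨ sym (bit-suc-[2k+b] i z′ b) ⟩
  bit (suc i) (2 * z′ + ⟦ b ⟧)                ∎
  where
  open ≡-Reasoning
  z′<2^j : z′ < 2 ^ j
  z′<2^j = 2z+b<2^[1+j]⇒z<2^j j z′ b z<

bit-high-[2^j*y+z] : ∀ j y z i → z < 2 ^ j → bit (j + i) (2 ^ j * y + z) ≡ bit i y
bit-high-[2^j*y+z] zero    y zero    i _ = cong (bit i) (trans (+-identityʳ (1 * y)) (*-identityˡ y))
bit-high-[2^j*y+z] zero    y (suc z) i (s≤s ())
bit-high-[2^j*y+z] (suc j) y z    i z< with halve z
... | z′ , b , refl rewrite 2^[1+j]y+[2z+b] j y z′ b =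
  trans (bit-suc-[2k+b] (j + i) (2 ^ j * y + z′) b)
        (bit-high-[2^j*y+z] j y z′ i (2z+b<2^[1+j]⇒z<2^j j z′ b z<))

bit-%-2^ : ∀ t x i → i < t → bit i (_%_ x (2 ^ t) {{m^n≢0 2 t}}) ≡ bit i x
bit-%-2^ t x i i<t = begin
  bit i (x % T)                  ≡⟨ bit-low-[2^j*y+z] t (x / T) (x % T) i (m%n<n x T) i<t ⟨
  bit i (T * (x / T) + x % T)    ≡⟨ cong (bit i) x≡ ⟨
  bit i x                        ∎
  where
  open ≡-Reasoning
  T : ℕ
  T = 2 ^ t
  instance
    T≢0 : NonZero T
    T≢0 = m^n≢0 2 t
  x≡ : x ≡ T * (x / T) + x % T
  x≡ = trans (m≡m%n+[m/n]*n x T) (trans (+-comm (x % T) _) (cong (_+ x % T) (*-comm (x / T) T)))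

bit-top-[2^j+r] : ∀ j r → r < 2 ^ j → bit j (2 ^ j + r) ≡ true
bit-top-[2^j+r] j r r< =
  subst₂ (λ i x → bit i x ≡ true) (+-identityʳ j) (cong (_+ r) (*-identityʳ (2 ^ j)))
    (bit-high-[2^j*y+z] j 1 r 0 r<)

bit-low-[2^j+r] : ∀ j r i → r < 2 ^ j → i < j → bit i (2 ^ j + r) ≡ bit i r
bit-low-[2^j+r] j r i r< i<j =
  subst (λ x → bit i x ≡ bit i r) (cong (_+ r) (*-identityʳ (2 ^ j)))
    (bit-low-[2^j*y+z] j 1 r i r< i<j)

⨁-applyUpTo-cong : ∀ g h L → (∀ p → g p ≡ h p) → ⨁ (applyUpTo g L) ≡ ⨁ (applyUpTo h L)
⨁-applyUpTo-cong g h zero    g≗h = refl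
⨁-applyUpTo-cong g h (suc L) g≗h =
  cong₂ _xor_ (g≗h 0) (⨁-applyUpTo-cong (g ∘ suc) (h ∘ suc) L (g≗h ∘ suc))

⨁-applyUpTo-false : ∀ g L → (∀ p → g p ≡ false) → ⨁ (applyUpTo g L) ≡ false
⨁-applyUpTo-false g zero    g≡false = refl
⨁-applyUpTo-false g (suc L) g≡false rewrite g≡false 0 =
  ⨁-applyUpTo-false (g ∘ suc) L (g≡false ∘ suc)

⨁-applyUpTo-extend : ∀ g L₀ L → (∀ p → L₀ ≤ p → g p ≡ false) → L₀ ≤ L →
  ⨁ (applyUpTo g L) ≡ ⨁ (applyUpTo g L₀)
⨁-applyUpTo-extend g zero     L       vanish _ = ⨁-applyUpTo-false g L (λ p → vanish p z≤n)
⨁-applyUpTo-extend g (suc L₀) (suc L) vanish (s≤s L₀≤L) =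
  cong (g 0 xor_) (⨁-applyUpTo-extend (g ∘ suc) L₀ L (λ p → vanish (suc p) ∘ s≤s) L₀≤L)

parityOn : (ℕ → Bool) → ℕ → Bool
parityOn S n = ⨁ (applyUpTo (λ p → S p ∧ bit p n) (suc n))

a≡parityOn : ∀ m n → a m n ≡ parityOn (λ p → andZero p m) n
a≡parityOn m n = cong ⨁ (map-upTo (λ p → andZero p m ∧ bit p n) (suc n))

c≡parityOn : ∀ m n → c m n ≡ parityOn (inC m) n
c≡parityOn m n = cong ⨁ (map-upTo (λ p → inC m p ∧ bit p n) (suc n))

parityOn-cong : ∀ S T n → (∀ p → S p ≡ T p) → parityOn S n ≡ parityOn T n
parityOn-cong S T n S≗T = ⨁-applyUpTo-cong _ _ (suc n) (λ p → cong (_∧ bit p n) (S≗T p))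

parityOn-[2k+b] : ∀ S k b → parityOn S (2 * k + ⟦ b ⟧) ≡ (S 0 ∧ b) xor parityOn (S ∘ suc) k
parityOn-[2k+b] S k b = cong₂ _xor_ (cong (S 0 ∧_) (bit-zero-[2k+b] k b)) (begin
  ⨁ (applyUpTo (λ p → S (suc p) ∧ bit (suc p) x) x)
    ≡⟨ ⨁-applyUpTo-cong _ g x (λ p → cong (S (suc p) ∧_) (bit-suc-[2k+b] p k b)) ⟩
  ⨁ (applyUpTo g x)
    ≡⟨ ⨁-applyUpTo-extend g k x g-vanish (≤-trans (m≤m+n k (k + 0)) (m≤m+n (2 * k) ⟦ b ⟧)) ⟩
  ⨁ (applyUpTo g k)
    ≡⟨ ⨁-applyUpTo-extend g k (suc k) g-vanish (n≤1+n k) ⟨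
  parityOn (S ∘ suc) k ∎)
  where
  open ≡-Reasoning
  x : ℕ
  x = 2 * k + ⟦ b ⟧
  g : ℕ → Bool
  g p = S (suc p) ∧ bit p k
  g-vanish : ∀ p → k ≤ p → g p ≡ false
  g-vanish p k≤p = trans (cong (S (suc p) ∧_) (bit-≤ p k k≤p)) (∧-zeroʳ (S (suc p)))

Alternating : (ℕ → Bool) → Set
Alternating f = ∀ k → f (suc (2 * k)) ≡ not (f (2 * k))

count-[2k] : ∀ f → Alternating f → ∀ k → count f (2 * k) ≡ k
count-[2k] f alt zero    = refl
count-[2k] f alt (suc k) = begin
  count f (2 * suc k)                    ≡⟨ cong (count f) (*-suc 2 k) ⟩
  count f x + ⟦ f x ⟧ + ⟦ f (suc x) ⟧    ≡⟨ cong (λ b → count f x + ⟦ f x ⟧ + ⟦ b ⟧) (alt k) ⟩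
  count f x + ⟦ f x ⟧ + ⟦ not (f x) ⟧    ≡⟨ +-assoc (count f x) ⟦ f x ⟧ ⟦ not (f x) ⟧ ⟩
  count f x + (⟦ f x ⟧ + ⟦ not (f x) ⟧)  ≡⟨ cong₂ _+_ (count-[2k] f alt k) (⟦b⟧+⟦not-b⟧≡1 (f x)) ⟩
  k + 1                                  ≡⟨ +-comm k 1 ⟩
  suc k                                  ∎
  where
  open ≡-Reasoning
  x : ℕ
  x = 2 * k
  ⟦b⟧+⟦not-b⟧≡1 : ∀ b → ⟦ b ⟧ + ⟦ not b ⟧ ≡ 1
  ⟦b⟧+⟦not-b⟧≡1 false = refl
  ⟦b⟧+⟦not-b⟧≡1 true  = refl

IsNth-alternating : ∀ f → Alternating f → ∀ k → IsNth f k (2 * k + ⟦ not (f (2 * k)) ⟧)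
IsNth-alternating f alt k with f (2 * k) in f[2k]≡
... | true  rewrite +-identityʳ (2 * k) = f[2k]≡ , count-[2k] f alt k
... | false rewrite +-comm (2 * k) 1 =
  trans (alt k) (cong not f[2k]≡) ,
  trans (cong (λ b → count f (2 * k) + ⟦ b ⟧) f[2k]≡) (trans (+-identityʳ _) (count-[2k] f alt k))

a-alternating : ∀ m → Alternating (a m)
a-alternating m k = begin
  a m (suc (2 * k))                    ≡⟨ cong (a m) (+-comm 1 (2 * k)) ⟩
  a m (2 * k + ⟦ true ⟧)               ≡⟨ a≡parityOn m (2 * k + 1) ⟩
  parityOn S (2 * k + ⟦ true ⟧)        ≡⟨ parityOn-[2k+b] S k true ⟩
  not (parityOn (S ∘ suc) k)           ≡⟨ cong not (parityOn-[2k+b] S k false) ⟨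
  not (parityOn S (2 * k + ⟦ false ⟧)) ≡⟨ cong not (a≡parityOn m (2 * k + 0)) ⟨
  not (a m (2 * k + 0))                ≡⟨ cong (not ∘ a m) (+-identityʳ (2 * k)) ⟩
  not (a m (2 * k))                    ∎
  where
  open ≡-Reasoning
  S : ℕ → Bool
  S p = andZero p m

U-a : ∀ m k → U m k (2 * k + ⟦ not (a m (2 * k)) ⟧)
U-a m = IsNth-alternating (a m) (a-alternating m)

V-a : ∀ m k → V m k (2 * k + ⟦ a m (2 * k) ⟧)
V-a m k = subst (λ b → V m k (2 * k + ⟦ b ⟧)) (not-involutive (a m (2 * k)))
  (IsNth-alternating (not ∘ a m) (cong not ∘ a-alternating m) k)

m+⟦not-b⟧≡m+1∸⟦b⟧ : ∀ m b → m + ⟦ not b ⟧ ≡ m + 1 ∸ ⟦ b ⟧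
m+⟦not-b⟧≡m+1∸⟦b⟧ m false = refl
m+⟦not-b⟧≡m+1∸⟦b⟧ m true  = trans (+-identityʳ m) (sym (m+n∸n≡m m 1))

U-V-at : ∀ m x b → a m (2 * x) ≡ b →
  U m x (2 * x + 1 ∸ ⟦ b ⟧) × V m x (2 * x + ⟦ b ⟧)
U-V-at m x b a≡b =
  subst (U m x) (m+⟦not-b⟧≡m+1∸⟦b⟧ (2 * x) b)
    (subst (λ c → U m x (2 * x + ⟦ not c ⟧)) a≡b (U-a m x)) ,
  subst (λ c → V m x (2 * x + ⟦ c ⟧)) a≡b (V-a m x)

U-V-at-not : ∀ m x b → a m (2 * x) ≡ not b →
  U m x (2 * x + ⟦ b ⟧) × V m x (2 * x + 1 ∸ ⟦ b ⟧)
U-V-at-not m x b a≡¬b =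
  subst (λ c → U m x (2 * x + ⟦ c ⟧)) (trans (cong not a≡¬b) (not-involutive b)) (U-a m x) ,
  subst (V m x) (m+⟦not-b⟧≡m+1∸⟦b⟧ (2 * x) b)
    (subst (λ c → V m x (2 * x + ⟦ c ⟧)) a≡¬b (V-a m x))

a-[4n+2e]≡parityOn : ∀ m n e →
  a m (2 * (2 * n + ⟦ e ⟧)) ≡ (andZero 1 m ∧ e) xor parityOn (λ p → andZero (2 + p) m) n
a-[4n+2e]≡parityOn m n e = begin
  a m (2 * x)                                ≡⟨ a≡parityOn m (2 * x) ⟩
  parityOn S (2 * x)                         ≡⟨ cong (parityOn S) (+-identityʳ (2 * x)) ⟨
  parityOn S (2 * x + ⟦ false ⟧)             ≡⟨ parityOn-[2k+b] S x false ⟩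
  parityOn (S ∘ suc) (2 * n + ⟦ e ⟧)         ≡⟨ parityOn-[2k+b] (S ∘ suc) n e ⟩
  (S 1 ∧ e) xor parityOn (S ∘ suc ∘ suc) n   ∎
  where
  open ≡-Reasoning
  x : ℕ
  x = 2 * n + ⟦ e ⟧
  S : ℕ → Bool
  S p = andZero p m

a-[4n]≡parityOn : ∀ m n → a m (4 * n) ≡ parityOn (λ p → andZero (2 + p) m) n
a-[4n]≡parityOn m n = begin
  a m (4 * n)                       ≡⟨ cong (a m) (4n≡2[2n+0] n) ⟩
  a m (2 * (2 * n + ⟦ false ⟧))     ≡⟨ a-[4n+2e]≡parityOn m n false ⟩
  (andZero 1 m ∧ false) xor P       ≡⟨ cong (_xor P) (∧-zeroʳ (andZero 1 m)) ⟩
  P                                 ∎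
  where
  open ≡-Reasoning
  P : Bool
  P = parityOn (λ p → andZero (2 + p) m) n
  4n≡2[2n+0] : ∀ n → 4 * n ≡ 2 * (2 * n + 0)
  4n≡2[2n+0] = solve-∀

a-[4n+2e] : ∀ m n e → a m (2 * (2 * n + ⟦ e ⟧)) ≡ (andZero 1 m ∧ e) xor a m (4 * n)
a-[4n+2e] m n e =
  trans (a-[4n+2e]≡parityOn m n e) (cong ((andZero 1 m ∧ e) xor_) (sym (a-[4n]≡parityOn m n)))

Disjoint : ℕ → ℕ → Set
Disjoint x m = ∀ i → bit i x ∧ bit i m ≡ false

and-applyUpTo⇒ : ∀ g L → and (applyUpTo g L) ≡ true → ∀ i → i < L → g i ≡ true
and-applyUpTo⇒ g (suc L) all-g zero    _ with g 0 | all-g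
... | true | _ = refl
and-applyUpTo⇒ g (suc L) all-g (suc i) (s≤s i<L) with g 0 | all-g
... | true | all-g′ = and-applyUpTo⇒ (g ∘ suc) L all-g′ i i<L

⇒and-applyUpTo : ∀ g L → (∀ i → i < L → g i ≡ true) → and (applyUpTo g L) ≡ true
⇒and-applyUpTo g zero    _     = refl
⇒and-applyUpTo g (suc L) all-g rewrite all-g 0 (s≤s z≤n) =
  ⇒and-applyUpTo (g ∘ suc) L (λ i → all-g (suc i) ∘ s≤s)

andZero⇔Disjoint : ∀ x m → andZero x m ≡ true ⇔ Disjoint x m
andZero⇔Disjoint x m = mk⇔ to from
  where
  g : ℕ → Bool
  g i = not (bit i x ∧ bit i m)
  andZero≡ : andZero x m ≡ and (applyUpTo g (suc x))
  andZero≡ = cong and (map-upTo g (suc x))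
  to : andZero x m ≡ true → Disjoint x m
  to az i with i ≤? x
  ... | yes i≤x = not-injective (and-applyUpTo⇒ g (suc x) (trans (sym andZero≡) az) i (s≤s i≤x))
  ... | no  i≰x = cong (_∧ bit i m) (bit-≤ i x (<⇒≤ (≰⇒> i≰x)))
  from : Disjoint x m → andZero x m ≡ true
  from disj = trans andZero≡ (⇒and-applyUpTo g (suc x) (λ i _ → cong not (disj i)))

andZero-cong : ∀ x m y m′ → (∀ i → bit i x ∧ bit i m ≡ bit i y ∧ bit i m′) →
  andZero x m ≡ andZero y m′
andZero-cong x m y m′ same = ⇔→≡ (mk⇔
  (λ az → from (andZero⇔Disjoint y m′) (λ i → trans (sym (same i)) (to (andZero⇔Disjoint x m) az i)))
  (λ az → from (andZero⇔Disjoint x m) (λ i → trans (same i) (to (andZero⇔Disjoint y m′) az i))))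
  where open Equivalence

andZero-%-2^ : ∀ t x m → m < 2 ^ t → andZero x m ≡ andZero (_%_ x (2 ^ t) {{m^n≢0 2 t}}) m
andZero-%-2^ t x m m<2^t = andZero-cong x m (x % 2 ^ t) m same
  where
  instance
    2^t≢0 : NonZero (2 ^ t)
    2^t≢0 = m^n≢0 2 t
  same : ∀ i → bit i x ∧ bit i m ≡ bit i (x % 2 ^ t) ∧ bit i m
  same i with i <? t
  ... | yes i<t = cong (_∧ bit i m) (sym (bit-%-2^ t x i i<t))
  ... | no  i≮t rewrite bit-< i m (<-≤-trans m<2^t (^-monoʳ-≤ 2 (≮⇒≥ i≮t))) =
    trans (∧-zeroʳ (bit i x)) (sym (∧-zeroʳ (bit i (x % 2 ^ t))))

andZero-low : ∀ j r y → r < 2 ^ j → y < 2 ^ j → andZero y (2 ^ j + r) ≡ andZero y r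
andZero-low j r y r<2^j y<2^j = andZero-cong y (2 ^ j + r) y r same
  where
  same : ∀ i → bit i y ∧ bit i (2 ^ j + r) ≡ bit i y ∧ bit i r
  same i with i <? j
  ... | yes i<j = cong (bit i y ∧_) (bit-low-[2^j+r] j r i r<2^j i<j)
  ... | no  i≮j rewrite bit-< i y (<-≤-trans y<2^j (^-monoʳ-≤ 2 (≮⇒≥ i≮j))) = refl

andZero-top : ∀ j r y → r < 2 ^ j → 2 ^ j ≤ y → y < 2 ^ suc j → andZero y (2 ^ j + r) ≡ false
andZero-top j r y r<2^j 2^j≤y y<2^[1+j] = ¬-not λ az → true≢false (begin
  true                         ≡⟨ cong₂ _∧_ bit-j-y (bit-top-[2^j+r] j r r<2^j) ⟨
  bit j y ∧ bit j (2 ^ j + r)  ≡⟨ Equivalence.to (andZero⇔Disjoint y (2 ^ j + r)) az j ⟩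
  false                        ∎)
  where
  open ≡-Reasoning
  y≡ : 2 ^ j + (y ∸ 2 ^ j) ≡ y
  y≡ = m+[n∸m]≡n 2^j≤y
  bit-j-y : bit j y ≡ true
  bit-j-y = subst (λ z → bit j z ≡ true) y≡ (bit-top-[2^j+r] j (y ∸ 2 ^ j) (+-cancelˡ-< (2 ^ j) _ _
    (subst₂ _<_ (sym y≡) (cong (2 ^ j +_) (+-identityʳ (2 ^ j))) y<2^[1+j])))
  true≢false : true ≢ false
  true≢false ()

andZero-2^t : ∀ t m → m < 2 ^ t → andZero (2 ^ t) m ≡ true
andZero-2^t t m m<2^t =
  trans (andZero-%-2^ t (2 ^ t) m m<2^t) (cong (λ x → andZero x m) (n%n≡0 (2 ^ t)))
  where
  instance
    2^t≢0 : NonZero (2 ^ t)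
    2^t≢0 = m^n≢0 2 t

andZero-one : ∀ m → andZero 1 m ≡ not (m % 2 ≡ᵇ 1)
andZero-one m = trans (cong (λ b → not b ∧ true) (bit-zero m)) (∧-identityʳ _)

andZero-one-odd : ∀ m → m % 2 ≡ 1 → andZero 1 m ≡ false
andZero-one-odd m m-odd = trans (andZero-one m) (cong (λ x → not (x ≡ᵇ 1)) m-odd)

andZero-one-even : ∀ m → m % 2 ≡ 0 → andZero 1 m ≡ true
andZero-one-even m m-even = trans (andZero-one m) (cong (λ x → not (x ≡ᵇ 1)) m-even)

andZero-1+2^t : ∀ t m → 1 ≤ t → m < 2 ^ t → m % 2 ≡ 1 → andZero (suc (2 ^ t)) m ≡ false
andZero-1+2^t t m 1≤t m<2^t m-odd = begin
  andZero (suc T) m        ≡⟨ andZero-%-2^ t (suc T) m m<2^t ⟩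
  andZero (suc T % T) m    ≡⟨ cong (λ x → andZero x m) (trans ([m+n]%n≡m%n 1 T) (m<n⇒m%n≡m 1<T)) ⟩
  andZero 1 m              ≡⟨ andZero-one-odd m m-odd ⟩
  false                    ∎
  where
  open ≡-Reasoning
  T : ℕ
  T = 2 ^ t
  instance
    T≢0 : NonZero T
    T≢0 = m^n≢0 2 t
  1<T : 1 < T
  1<T = ^-monoʳ-≤ 2 1≤t

binary-magnitude : ∀ m → 1 ≤ m → ∃[ j ] 2 ^ j ≤ m × m < 2 ^ suc j
binary-magnitude (suc zero)    _ = 0 , s≤s z≤n , s≤s (s≤s z≤n)
binary-magnitude (suc (suc m)) _ with binary-magnitude (suc m) (s≤s z≤n)
... | j , lo , hi with m≤n⇒m<n∨m≡n hi
...   | inj₁ 2+m<2^[1+j] = j , ≤-trans lo (n≤1+n (suc m)) , 2+m<2^[1+j]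
...   | inj₂ 2+m≡2^[1+j] = suc j , ≤-reflexive (sym 2+m≡2^[1+j]) ,
  subst (_< 2 ^ suc (suc j)) (sym 2+m≡2^[1+j]) (^-monoʳ-< 2 (s≤s (s≤s z≤n)) (n<1+n (suc j)))

⌈log₂[1+2^j]⌉≡1+j : ∀ j → ⌈log₂ (suc (2 ^ j)) ⌉ ≡ suc j
⌈log₂[1+2^j]⌉≡1+j zero    = refl
⌈log₂[1+2^j]⌉≡1+j (suc j) = ∸1-injective (begin
  ⌈log₂ (suc (2 ^ suc j)) ⌉ ∸ 1      ≡⟨ ⌈log₂⌈n/2⌉⌉≡⌈log₂n⌉∸1 (suc (2 ^ suc j)) ⟨
  ⌈log₂ ⌈ suc (2 ^ suc j) /2⌉ ⌉      ≡⟨ cong ⌈log₂_⌉ ⌈[1+2^[1+j]]/2⌉≡1+2^j ⟩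
  ⌈log₂ (suc (2 ^ j)) ⌉              ≡⟨ ⌈log₂[1+2^j]⌉≡1+j j ⟩
  suc j                              ∎)
  where
  open ≡-Reasoning
  ⌈[1+2^[1+j]]/2⌉≡1+2^j : ⌈ suc (2 ^ suc j) /2⌉ ≡ suc (2 ^ j)
  ⌈[1+2^[1+j]]/2⌉≡1+2^j =
    cong suc (trans (cong ⌊_/2⌋ (cong (2 ^ j +_) (+-identityʳ (2 ^ j)))) (sym (n≡⌊n+n/2⌋ (2 ^ j))))
  ∸1-injective : ∀ {x} → x ∸ 1 ≡ suc j → x ≡ suc (suc j)
  ∸1-injective {suc x} x∸1≡ = cong suc x∸1≡

K-magnitude : ∀ m j → 2 ^ j ≤ m → m < 2 ^ suc j → K m ≡ suc j
K-magnitude m j lo hi = cong (1 ⊔_) (≤-antisym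
  (subst (⌈log₂ (suc m) ⌉ ≤_) (⌈log₂2^n⌉≡n (suc j)) (⌈log₂⌉-mono-≤ hi))
  (subst (_≤ ⌈log₂ (suc m) ⌉) (⌈log₂[1+2^j]⌉≡1+j j) (⌈log₂⌉-mono-≤ (s≤s lo))))

-- The odd-m clause of inC-fuel once K m = suc j is known, with B standing for the recursive
-- answer inC-fuel f (m ∸ 2 ^ j) s.
inC-step : ℕ → Bool → ℕ → Bool
inC-step j B s = (s ≡ᵇ 2 ^ suc j ∸ 2) ∨ ((s <ᵇ 2 ^ j ∸ 2) ∧ B)

inC-fuel-odd : ∀ f m j q → m % 2 ≡ 1 → K m ≡ suc j →
  let s = _%_ q (2 ^ suc j) {{m^n≢0 2 (suc j)}} in
  inC-fuel (suc f) m q ≡ inC-step j (inC-fuel f (m ∸ 2 ^ j) s) s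
inC-fuel-odd f (suc k) j q m-odd Km≡ =
  trans (cong (λ odd? → if odd? then step (K (suc k)) else inC-fuel f k q) (cong (_≡ᵇ 1) m-odd))
        (cong step Km≡)
  where
  step : ℕ → Bool
  step K′ = let s = _%_ q (2 ^ K′) {{m^n≢0 2 K′}} in
    (s ≡ᵇ 2 ^ K′ ∸ 2) ∨ ((s <ᵇ 2 ^ (K′ ∸ 1) ∸ 2) ∧ inC-fuel f (suc k ∸ 2 ^ (K′ ∸ 1)) s)

private
  [s≡ᵇn∸2]≡[2+s≡ᵇn] : ∀ s n → 2 ≤ n → (s ≡ᵇ n ∸ 2) ≡ (2 + s ≡ᵇ n)
  [s≡ᵇn∸2]≡[2+s≡ᵇn] s (suc (suc n)) _           = refl
  [s≡ᵇn∸2]≡[2+s≡ᵇn] s (suc zero)    (s≤s ())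

  [s<ᵇn∸2]≡[2+s<ᵇn] : ∀ s n → (s <ᵇ n ∸ 2) ≡ (2 + s <ᵇ n)
  [s<ᵇn∸2]≡[2+s<ᵇn] s zero          = refl
  [s<ᵇn∸2]≡[2+s<ᵇn] s (suc zero)    = refl
  [s<ᵇn∸2]≡[2+s<ᵇn] s (suc (suc n)) = refl

-- Cases on 2 + s ∈ [2, 2^(j+1) + 1]: below 2^j only the bits of r matter; in [2^j, 2^(j+1)) bit j
-- collides with the top bit of m; 2^(j+1) is disjoint from m; 2^(j+1) + 1 meets the odd m in bit 0.
inC-step-correct : ∀ j r s B → r < 2 ^ j → (2 ^ j + r) % 2 ≡ 1 → s < 2 ^ suc j →
  (2 + s < 2 ^ j → B ≡ andZero (2 + s) r) → inC-step j B s ≡ andZero (2 + s) (2 ^ j + r)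
inC-step-correct j r s B r<H m-odd s<N rec = begin
  inC-step j B s
    ≡⟨ cong₂ (λ x y → x ∨ (y ∧ B)) ([s≡ᵇn∸2]≡[2+s≡ᵇn] s N 2≤N) ([s<ᵇn∸2]≡[2+s<ᵇn] s H) ⟩
  (2 + s ≡ᵇ N) ∨ ((2 + s <ᵇ H) ∧ B)
    ≡⟨ by-cases ⟩
  andZero (2 + s) m
    ∎
  where
  open ≡-Reasoning
  H N m : ℕ
  H = 2 ^ j
  N = 2 ^ suc j
  m = H + r
  2≤N : 2 ≤ N
  2≤N = ^-monoʳ-≤ 2 {1} {suc j} (s≤s z≤n)
  H≤N : H ≤ N
  H≤N = ^-monoʳ-≤ 2 (n≤1+n j)
  m<N : m < N
  m<N = subst (m <_) (cong (H +_) (sym (+-identityʳ H))) (+-monoʳ-< H r<H)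
  by-cases : (2 + s ≡ᵇ N) ∨ ((2 + s <ᵇ H) ∧ B) ≡ andZero (2 + s) m
  by-cases with <-cmp (2 + s) N
  ... | tri< 2+s<N 2+s≢N _ with 2 + s <? H
  ...   | yes 2+s<H rewrite dec-false (2 + s ≟ N) 2+s≢N | dec-true (2 + s <? H) 2+s<H =
    trans (rec 2+s<H) (sym (andZero-low j r (2 + s) r<H 2+s<H))
  ...   | no 2+s≮H rewrite dec-false (2 + s ≟ N) 2+s≢N | dec-false (2 + s <? H) 2+s≮H =
    sym (andZero-top j r (2 + s) r<H (≮⇒≥ 2+s≮H) 2+s<N)
  by-cases | tri≈ _ 2+s≡N _ rewrite dec-true (2 + s ≟ N) 2+s≡N =
    sym (trans (cong (λ x → andZero x m) 2+s≡N) (andZero-2^t (suc j) m m<N))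
  by-cases | tri> 2+s≮N 2+s≢N N<2+s
    rewrite dec-false (2 + s ≟ N) 2+s≢N
          | dec-false (2 + s <? H) (λ 2+s<H → 2+s≮N (<-≤-trans 2+s<H H≤N)) =
    sym (trans (cong (λ x → andZero x m) 2+s≡1+N) (andZero-1+2^t (suc j) m (s≤s z≤n) m<N m-odd))
    where
    2+s≡1+N : 2 + s ≡ suc N
    2+s≡1+N = ≤-antisym (s≤s s<N) N<2+s

andZero-[2+q]≡[2+q%2^t] : ∀ t q m → m < 2 ^ t →
  andZero (2 + q) m ≡ andZero (2 + _%_ q (2 ^ t) {{m^n≢0 2 t}}) m
andZero-[2+q]≡[2+q%2^t] t q m m<2^t = begin
  andZero (2 + q) m                ≡⟨ andZero-%-2^ t (2 + q) m m<2^t ⟩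
  andZero ((2 + q) % T) m          ≡⟨ cong (λ x → andZero x m) [2+q]%T≡[2+q%T]%T ⟩
  andZero ((2 + q % T) % T) m      ≡⟨ andZero-%-2^ t (2 + q % T) m m<2^t ⟨
  andZero (2 + q % T) m            ∎
  where
  open ≡-Reasoning
  T : ℕ
  T = 2 ^ t
  instance
    T≢0 : NonZero T
    T≢0 = m^n≢0 2 t
  [2+q]%T≡[2+q%T]%T : (2 + q) % T ≡ (2 + q % T) % T
  [2+q]%T≡[2+q%T]%T = begin
    (2 + q) % T                ≡⟨ %-distribˡ-+ 2 q T ⟩
    (2 % T + q % T) % T        ≡⟨ cong (λ x → (2 % T + x) % T) (m%n%n≡m%n q T) ⟨
    (2 % T + q % T % T) % T    ≡⟨ %-distribˡ-+ 2 (q % T) T ⟨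
    (2 + q % T) % T            ∎

2∣2^j : ∀ j → 1 < 2 ^ j → 2 ∣ 2 ^ j
2∣2^j zero    (s≤s ())
2∣2^j (suc j) _ = m∣m*n (2 ^ j)

inC-fuel-correct : ∀ f m q → m < f → m % 2 ≡ 1 → inC-fuel f m q ≡ andZero (2 + q) m
inC-fuel-correct (suc f) (suc k) q (s≤s m≤f) m-odd with binary-magnitude (suc k) (s≤s z≤n)
... | j , 2^j≤m , m<2^[1+j] = begin
  inC-fuel (suc f) m q
    ≡⟨ inC-fuel-odd f m j q m-odd (K-magnitude m j 2^j≤m m<2^[1+j]) ⟩
  inC-step j (inC-fuel f r s) s
    ≡⟨ inC-step-correct j r s (inC-fuel f r s) r<2^j [2^j+r]-odd (m%n<n q N) rec ⟩
  andZero (2 + s) (2 ^ j + r)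
    ≡⟨ cong (andZero (2 + s)) 2^j+r≡m ⟩
  andZero (2 + s) m
    ≡⟨ andZero-[2+q]≡[2+q%2^t] (suc j) q m m<2^[1+j] ⟨
  andZero (2 + q) m
    ∎
  where
  open ≡-Reasoning
  m r N s : ℕ
  m = suc k
  r = m ∸ 2 ^ j
  N = 2 ^ suc j
  instance
    N≢0 : NonZero N
    N≢0 = m^n≢0 2 (suc j)
  s = q % N
  2^j+r≡m : 2 ^ j + r ≡ m
  2^j+r≡m = m+[n∸m]≡n 2^j≤m
  r<2^j : r < 2 ^ j
  r<2^j = +-cancelˡ-< (2 ^ j) r (2 ^ j)
    (subst₂ _<_ (sym 2^j+r≡m) (cong (2 ^ j +_) (+-identityʳ (2 ^ j))) m<2^[1+j])
  [2^j+r]-odd : (2 ^ j + r) % 2 ≡ 1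
  [2^j+r]-odd = trans (cong (_% 2) 2^j+r≡m) m-odd
  rec : 2 + s < 2 ^ j → inC-fuel f r s ≡ andZero (2 + s) r
  rec 2+s<2^j = inC-fuel-correct f r s (≤-<-trans (∸-monoʳ-≤ m (m^n>0 2 j)) m≤f)
    (trans (sym (%-remove-+ˡ r (2∣2^j j (≤-trans (s≤s (s≤s z≤n)) 2+s<2^j)))) [2^j+r]-odd)

andZero-[2+q]≡inC : ∀ m q → m % 2 ≡ 1 → andZero (2 + q) m ≡ inC m q
andZero-[2+q]≡inC m q m-odd = sym (inC-fuel-correct (suc m) m q ≤-refl m-odd)

a-[4n]≡c : ∀ m n → m % 2 ≡ 1 → a m (4 * n) ≡ c m n
a-[4n]≡c m n m-odd = begin
  a m (4 * n)                           ≡⟨ a-[4n]≡parityOn m n ⟩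
  parityOn (λ p → andZero (2 + p) m) n  ≡⟨ parityOn-cong _ (inC m) n (λ q → andZero-[2+q]≡inC m q m-odd) ⟩
  parityOn (inC m) n                    ≡⟨ c≡parityOn m n ⟨
  c m n                                 ∎
  where open ≡-Reasoning

a-[4n+2e]-odd : ∀ m n e → m % 2 ≡ 1 → a m (2 * (2 * n + ⟦ e ⟧)) ≡ c m n
a-[4n+2e]-odd m n e m-odd = begin
  a m (2 * (2 * n + ⟦ e ⟧))          ≡⟨ a-[4n+2e] m n e ⟩
  (andZero 1 m ∧ e) xor a m (4 * n)  ≡⟨ cong (λ b → (b ∧ e) xor a m (4 * n)) (andZero-one-odd m m-odd) ⟩
  a m (4 * n)                        ≡⟨ a-[4n]≡c m n m-odd ⟩
  c m n                              ∎
  where open ≡-Reasoning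

a-[4n+2e]-even : ∀ m n e → m % 2 ≡ 0 → a m (2 * (2 * n + ⟦ e ⟧)) ≡ e xor a m (4 * n)
a-[4n+2e]-even m n e m-even =
  trans (a-[4n+2e] m n e) (cong (λ b → (b ∧ e) xor a m (4 * n)) (andZero-one-even m m-even))

theorem34 : (m m' n : ℕ) →
    (m % 2 ≡ 1 →
        (∃[ x ] (U m' n x × U m x (2 * x + 1 ∸ ⟦ c m n ⟧)))
      × (∃[ x ] (V m' n x × V m x (2 * x + ⟦ c m n ⟧)))
      × (∃[ x ] (V m' n x × U m x (2 * x + 1 ∸ ⟦ c m n ⟧)))
      × (∃[ x ] (U m' n x × V m x (2 * x + ⟦ c m n ⟧))))
    × (2 ≤ m → m % 2 ≡ 0 →
        (∃[ x ] (U m' n x × U m x (2 * x + ⟦ γ m m' n ⟧)))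
      × (∃[ x ] (V m' n x × V m x (2 * x + ⟦ γ m m' n ⟧)))
      × (∃[ x ] (V m' n x × U m x (2 * x + 1 ∸ ⟦ γ m m' n ⟧)))
      × (∃[ x ] (U m' n x × V m x (2 * x + 1 ∸ ⟦ γ m m' n ⟧))))
theorem34 m m' n =
  (λ m-odd →
    let u = U-V-at m uₙ (c m n) (a-[4n+2e]-odd m n (not a′) m-odd)
        v = U-V-at m vₙ (c m n) (a-[4n+2e]-odd m n a′ m-odd)
    in (uₙ , U-a m' n , proj₁ u) , (vₙ , V-a m' n , proj₂ v) ,
       (vₙ , V-a m' n , proj₁ v) , (uₙ , U-a m' n , proj₂ u)) ,
  -- the hypothesis 2 ≤ m is not needed: the even case holds for m = 0 as well
  (λ _ m-even →
    let u = U-V-at-not m uₙ (γ m m' n) (trans (a-[4n+2e]-even m n (not a′) m-even) ¬a′⊕a₄≡¬γ)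
        v = U-V-at m vₙ (γ m m' n) (trans (a-[4n+2e]-even m n a′ m-even) (xor-comm a′ (a m (4 * n))))
    in (uₙ , U-a m' n , proj₁ u) , (vₙ , V-a m' n , proj₂ v) ,
       (vₙ , V-a m' n , proj₁ v) , (uₙ , U-a m' n , proj₂ u))
  where
  a′ : Bool
  a′ = a m' (2 * n)
  uₙ vₙ : ℕ
  uₙ = 2 * n + ⟦ not a′ ⟧
  vₙ = 2 * n + ⟦ a′ ⟧
  ¬a′⊕a₄≡¬γ : not a′ xor a m (4 * n) ≡ not (γ m m' n)
  ¬a′⊕a₄≡¬γ = trans (sym (not-distribˡ-xor a′ (a m (4 * n)))) (cong not (xor-comm a′ (a m (4 * n))))
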